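{- Let $n\ge 3$ be an integer. For any edge-coloring of $K_{n}$ with $3$ colors, there exists a set $S\subseteq V(K_{n})$ with $|S|=3$ such that the maximum number of pairwise internally disjoint rainbow $S$-trees in $K_n$ is at most $\frac{2(n-1)^{2}}{9(n-2)}+3$.
   Context: An edge-coloring of a graph $G$ is any map $c:E(G)\to\{1,\dots,t\}$ (adjacent edges may receive the same color). A tree is rainbow if no two of its edges have the same color. For $S\subseteq V(G)$, a rainbow $S$-tree is a rainbow tree in $G$ whose vertex set contains $S$. $S$-trees $T_1,\dots,T_m$ are internally disjoint if $E(T_i)\cap E(T_j)=\emptyset$ and $V(T_i)\cap V(T_j)=S$ for all $i\ne j$. $K_n$ is the complete graph on $n$ vertices. -}

module Defs where

open import Data.Nat using (ℕ; _≤_; _+_; _*_; _∸_; _^_)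
open import Data.Fin using (Fin; _<_)
open import Data.Fin.Subset using (Subset; _∈_; _⊆_; ∣_∣)
open import Data.Product using (Σ; _×_; _,_; proj₁; proj₂)
open import Data.Sum using (_⊎_)
open import Data.List using (List; []; _∷_; length)
open import Data.List.Relation.Unary.Unique.Propositional using (Unique)
open import Data.List.Relation.Unary.AllPairs using (AllPairs)
import Data.List.Membership.Propositional as L
open import Relation.Binary.PropositionalEquality using (_≡_; _≢_)
open import Relation.Nullary using (¬_)

-- An (unordered) edge {u,v} of K_n
-- is represented canonically by the ordered pair (u , v) with u < v, and its
-- colour is c u v; values c u v with u ≥ v are never used.
Coloring : ℕ → Set
Coloring n = Fin n → Fin n → Fin 3

-- candidate edge (u , v), to be used only with u < v
Edge : ℕ → Set
Edge n = Fin n × Fin n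

colour : ∀ {n} → Coloring n → Edge n → Fin 3
colour c (u , v) = c u v

record Subgraph (n : ℕ) : Set where
  constructor mkSubgraph
  field
    V : Subset n
    E : List (Edge n)
open Subgraph public

Adj : ∀ {n} → List (Edge n) → Fin n → Fin n → Set
Adj E u v = ((u , v) L.∈ E) ⊎ ((v , u) L.∈ E)

data Walk {n : ℕ} (E : List (Edge n)) : Fin n → Fin n → Set where
  here : ∀ {u} → Walk E u u
  step : ∀ {u w v} → Adj E u w → Walk E w v → Walk E u v

PathVia : ∀ {n} → List (Edge n) → Fin n → List (Fin n) → Fin n → Set
PathVia E x [] y = Adj E x y
PathVia E x (w ∷ ws) y = Adj E x w × PathVia E w ws y

HasCycle : ∀ {n} → List (Edge n) → Set
HasCycle {n} E =
  Σ (Fin n) λ v0 → Σ (List (Fin n)) λ ws →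
    (2 ≤ length ws) × Unique (v0 ∷ ws) × PathVia E v0 ws v0

WellFormed : ∀ {n} → Subgraph n → Set
WellFormed G =
  Unique (E G) ×
  (∀ e → e L.∈ E G → (proj₁ e < proj₂ e) × (proj₁ e ∈ V G) × (proj₂ e ∈ V G))

IsConnected : ∀ {n} → Subgraph n → Set
IsConnected G = ∀ u v → u ∈ V G → v ∈ V G → Walk (E G) u v

IsTree : ∀ {n} → Subgraph n → Set
IsTree G = WellFormed G × IsConnected G × ¬ HasCycle (E G)

Rainbow : ∀ {n} → Coloring n → Subgraph n → Set
Rainbow c G = AllPairs (λ e f → colour c e ≢ colour c f) (E G)

RainbowSTree : ∀ {n} → Coloring n → Subset n → Subgraph n → Set
RainbowSTree c S T = IsTree T × Rainbow c T × (S ⊆ V T)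

InternallyDisjoint : ∀ {n} → Subset n → Subgraph n → Subgraph n → Set
InternallyDisjoint S T₁ T₂ =
  (∀ e → e L.∈ E T₁ → ¬ (e L.∈ E T₂)) ×
  (∀ x → x ∈ V T₁ → x ∈ V T₂ → x ∈ S)

module Submission where

-- A rainbow S-tree T either contains one of the 3 edges inside S, or each s ∈ S has a
-- neighbour outside S; the three spokes then have distinct colours, exhaust the 3
-- colours and so are all of T, and connectivity makes T a star whose centre x ∉ S sees
-- S in three colours (a rainbow centre of S).  Disjoint trees have distinct inner edges
-- and centres, so there are at most 3 + R(S) of them (TreeShape).  A vertex with
-- d₀, d₁, d₂ neighbours per colour is a rainbow centre for 6d₀d₁d₂ ≤ 2(n-1)³/9 ordered
-- triples (AM–GM), so averaging over the n(n-1)(n-2) triples of distinct vertices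
-- yields S with 9(n-2)R(S) ≤ 2(n-1)² (few-centres).

open import Defs
open import Data.Nat using (ℕ; zero; suc; _≤_; _<_; _+_; _*_; _∸_; _^_; z≤n; s≤s)
  renaming (_<?_ to _<ℕ?_)
open import Data.Nat.Properties
  using ( +-*-semiring; +-comm; +-assoc; *-comm; +-identityʳ; *-identityʳ; *-zeroʳ
        ; ≤-trans; ≤-<-trans; <⇒≤; ≤-total; ≮⇒≥; n<1+n; m≤m+n; m≤n+m; m+n∸n≡m; m+[n∸m]≡n
        ; +-mono-≤; +-monoˡ-≤; +-monoʳ-≤; *-monoʳ-≤; *-monoʳ-<; *-cancelˡ-≤; +-cancelˡ-<
        ; module ≤-Reasoning)
open import Data.Nat.Tactic.RingSolver using (solve-∀; solve)
open import Data.Fin using (Fin; zero; suc) renaming (_≤?_ to _≤ᶠ?_; _<_ to _<ᶠ_)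
open import Data.Fin.Properties
  using (_≟_; any?; all?; suc-injective; injective⇒≤; <-asym; <-irrefl)
  renaming (≤-antisym to ≤ᶠ-antisym; ≤-total to ≤ᶠ-total)
open import Data.Fin.Subset using (Subset; ∣_∣) renaming (_∈_ to _∈ₛ_)
open import Data.Fin.Subset.Properties using (_∈?_)
open import Data.Bool using (Bool; true; false; if_then_else_)
open import Data.Empty using (⊥)
open import Data.Product using (Σ; ∃; _×_; _,_; proj₁; proj₂)
open import Data.Sum using (_⊎_; inj₁; inj₂)
open import Data.Sum.Properties using (inj₁-injective)
open import Data.List using (List; []; _∷_; length; map; _++_; allFin; lookup)
open import Data.List.Properties using (length-map; length-++; length-tabulate)
import Data.List.Relation.Unary.Any as Any
open import Data.List.Relation.Unary.Any.Properties using (lookup-index)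
import Data.List.Relation.Unary.All as All
open import Data.List.Relation.Unary.AllPairs using (AllPairs; []; _∷_)
open import Data.List.Membership.Propositional using (_∈_; find; lose)
open import Data.List.Membership.Propositional.Properties using (∈-map⁺; ∈-++⁺ˡ; ∈-++⁺ʳ; ∈-allFin)
import Data.Vec as Vec
open import Data.Vec.Properties using (lookup∘tabulate; []=⇒lookup; lookup⇒[]=)
open import Function using (_∘_)
open import Function.Definitions using (Injective)
open import Relation.Nullary using (Dec; yes; no; does; ¬?; contradiction)
open import Relation.Nullary.Decidable using (_×-dec_; _⊎-dec_; _→-dec_; toWitness; dec-true)
open import Relation.Binary.PropositionalEquality
open import Algebra.Properties.Semiring.Sum +-*-semiring
  using (sum; sum-syntax; ∑-comm; ∑-distrib-+; *-distribˡ-sum; *-distribʳ-sum; sum-cong-≗)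

⟦_⟧ : ∀ {p} {P : Set p} → Dec P → ℕ
⟦ P? ⟧ = if does P? then 1 else 0

⟦⟧-yes : ∀ {p} {P : Set p} (P? : Dec P) → P → ⟦ P? ⟧ ≡ 1
⟦⟧-yes (yes _) _ = refl
⟦⟧-yes (no ¬p) p = contradiction p ¬p

⟦¬⟧+⟦⟧ : ∀ {p} {P : Set p} (P? : Dec P) → ⟦ ¬? P? ⟧ + ⟦ P? ⟧ ≡ 1
⟦¬⟧+⟦⟧ (yes _) = refl
⟦¬⟧+⟦⟧ (no _) = refl

⟦×⟧ : ∀ {p q} {P : Set p} {Q : Set q} (P? : Dec P) (Q? : Dec Q) → ⟦ P? ×-dec Q? ⟧ ≡ ⟦ P? ⟧ * ⟦ Q? ⟧
⟦×⟧ (yes _) (yes _) = refl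
⟦×⟧ (yes _) (no _) = refl
⟦×⟧ (no _) _ = refl

+⇒∸ : ∀ {x k n} → x + k ≡ n → x ≡ n ∸ k
+⇒∸ {x} {k} eq = trans (sym (m+n∸n≡m x k)) (cong (_∸ k) eq)

sum-const : ∀ n k → ∑[ i < n ] k ≡ n * k
sum-const zero k = refl
sum-const (suc n) k = cong (k +_) (sum-const n k)

sum-mono-≤ : ∀ {n} {f g : Fin n → ℕ} → (∀ i → f i ≤ g i) → sum f ≤ sum g
sum-mono-≤ {zero} _ = z≤n
sum-mono-≤ {suc n} f≤g = +-mono-≤ (f≤g zero) (sum-mono-≤ (f≤g ∘ suc))

term≤sum : ∀ {n} (f : Fin n → ℕ) i → f i ≤ sum f
term≤sum f zero = m≤m+n (f zero) _
term≤sum f (suc i) = ≤-trans (term≤sum (f ∘ suc) i) (m≤n+m _ (f zero))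

sum-<-witness : ∀ {n} (f g : Fin n → ℕ) → sum f < sum g → ∃ λ i → f i < g i
sum-<-witness {suc n} f g lt with f zero <ℕ? g zero
... | yes f₀<g₀ = zero , f₀<g₀
... | no f₀≮g₀ with sum-<-witness (f ∘ suc) (g ∘ suc) rest<rest
  where
  rest<rest : sum (f ∘ suc) < sum (g ∘ suc)
  rest<rest = +-cancelˡ-< (g zero) _ _ (≤-<-trans (+-monoˡ-≤ (sum (f ∘ suc)) (≮⇒≥ f₀≮g₀)) lt)
... | i , fᵢ<gᵢ = suc i , fᵢ<gᵢ

count-≡ : ∀ {n} (a : Fin n) → ∑[ y < n ] ⟦ a ≟ y ⟧ ≡ 1
count-≡ {suc n} zero = cong suc (trans (sum-const n 0) (*-zeroʳ n))
count-≡ (suc a) = count-≡ a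

count-≢ : ∀ {n} (a : Fin n) → ∑[ y < n ] ⟦ ¬? (a ≟ y) ⟧ ≡ n ∸ 1
count-≢ {n} a = +⇒∸ (begin
  ∑[ y < n ] ⟦ ¬? (a ≟ y) ⟧ + 1                       ≡⟨ cong (∑[ y < n ] ⟦ ¬? (a ≟ y) ⟧ +_) (count-≡ a) ⟨
  ∑[ y < n ] ⟦ ¬? (a ≟ y) ⟧ + ∑[ y < n ] ⟦ a ≟ y ⟧    ≡⟨ ∑-distrib-+ (λ y → ⟦ ¬? (a ≟ y) ⟧) (λ y → ⟦ a ≟ y ⟧) ⟨
  ∑[ y < n ] (⟦ ¬? (a ≟ y) ⟧ + ⟦ a ≟ y ⟧)             ≡⟨ sum-cong-≗ (λ y → ⟦¬⟧+⟦⟧ (a ≟ y)) ⟩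
  ∑[ y < n ] 1                                         ≡⟨ trans (sum-const n 1) (*-identityʳ n) ⟩
  n                                                    ∎)
  where open ≡-Reasoning

count-≢₂ : ∀ {n} {a b : Fin n} → a ≢ b → ∑[ y < n ] (⟦ ¬? (a ≟ y) ⟧ * ⟦ ¬? (b ≟ y) ⟧) ≡ n ∸ 2
count-≢₂ {n} {a} {b} a≢b = +⇒∸ (begin
  ∑[ y < n ] avoids y + 2                                   ≡⟨ cong (sum avoids +_) (cong₂ _+_ (count-≡ a) (count-≡ b)) ⟨
  ∑[ y < n ] avoids y + (∑[ y < n ] ⟦ a ≟ y ⟧ + ∑[ y < n ] ⟦ b ≟ y ⟧)
                                                            ≡⟨ cong (sum avoids +_) (∑-distrib-+ (λ y → ⟦ a ≟ y ⟧) (λ y → ⟦ b ≟ y ⟧)) ⟨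
  ∑[ y < n ] avoids y + ∑[ y < n ] (⟦ a ≟ y ⟧ + ⟦ b ≟ y ⟧) ≡⟨ ∑-distrib-+ avoids (λ y → ⟦ a ≟ y ⟧ + ⟦ b ≟ y ⟧) ⟨
  ∑[ y < n ] (avoids y + (⟦ a ≟ y ⟧ + ⟦ b ≟ y ⟧))         ≡⟨ sum-cong-≗ one-case ⟩
  ∑[ y < n ] 1                                              ≡⟨ trans (sum-const n 1) (*-identityʳ n) ⟩
  n                                                         ∎)
  where
  open ≡-Reasoning
  avoids : Fin n → ℕ
  avoids y = ⟦ ¬? (a ≟ y) ⟧ * ⟦ ¬? (b ≟ y) ⟧
  one-case : ∀ y → avoids y + (⟦ a ≟ y ⟧ + ⟦ b ≟ y ⟧) ≡ 1
  one-case y with a ≟ y | b ≟ y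
  ... | yes a≡y | yes b≡y = contradiction (trans a≡y (sym b≡y)) a≢b
  ... | yes _ | no _ = refl
  ... | no _ | yes _ = refl
  ... | no _ | no _ = refl

∑³ : ∀ {n} → (Fin n → Fin n → Fin n → ℕ) → ℕ
∑³ {n} f = ∑[ a < n ] ∑[ b < n ] ∑[ d < n ] f a b d

∑³-cong : ∀ {n} {f g : Fin n → Fin n → Fin n → ℕ} → (∀ a b d → f a b d ≡ g a b d) → ∑³ f ≡ ∑³ g
∑³-cong f≡g = sum-cong-≗ λ a → sum-cong-≗ λ b → sum-cong-≗ λ d → f≡g a b d

∑³-*ˡ : ∀ {n} k (f : Fin n → Fin n → Fin n → ℕ) → ∑³ (λ a b d → k * f a b d) ≡ k * ∑³ f
∑³-*ˡ {n} k f = sym (trans (*-distribˡ-sum k (λ a → ∑[ b < n ] sum (f a b))) (sum-cong-≗ λ a →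
                 trans (*-distribˡ-sum k (λ b → sum (f a b))) (sum-cong-≗ λ b → *-distribˡ-sum k (f a b))))

∑³-*ʳ : ∀ {n} k (f : Fin n → Fin n → Fin n → ℕ) → ∑³ (λ a b d → f a b d * k) ≡ ∑³ f * k
∑³-*ʳ k f = trans (∑³-cong λ a b d → *-comm (f a b d) k) (trans (∑³-*ˡ k f) (*-comm k (∑³ f)))

∑³-comm : ∀ {m n} (f : Fin m → Fin n → Fin n → Fin n → ℕ) →
  ∑³ (λ a b d → ∑[ k < m ] f k a b d) ≡ ∑[ k < m ] ∑³ (f k)
∑³-comm f =
  trans (sum-cong-≗ λ a → sum-cong-≗ λ b → ∑-comm (λ d k → f k a b d))
  (trans (sum-cong-≗ λ a → ∑-comm (λ b k → ∑[ d < _ ] f k a b d))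
         (∑-comm (λ a k → ∑[ b < _ ] ∑[ d < _ ] f k a b d)))

∑³-swap : ∀ {m n} (f : Fin m → Fin m → Fin m → Fin n → Fin n → Fin n → ℕ) →
  ∑³ (λ a b d → ∑³ (λ k₁ k₂ k₃ → f k₁ k₂ k₃ a b d)) ≡ ∑³ (λ k₁ k₂ k₃ → ∑³ (f k₁ k₂ k₃))
∑³-swap f =
  trans (∑³-comm λ k₁ a b d → ∑[ k₂ < _ ] ∑[ k₃ < _ ] f k₁ k₂ k₃ a b d)
  (sum-cong-≗ λ k₁ → trans (∑³-comm λ k₂ a b d → ∑[ k₃ < _ ] f k₁ k₂ k₃ a b d)
  (sum-cong-≗ λ k₂ → ∑³-comm (f k₁ k₂)))

∑³-product : ∀ {n} (f g h : Fin n → ℕ) → ∑³ (λ a b d → f a * g b * h d) ≡ sum f * sum g * sum h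
∑³-product f g h = begin
  ∑³ (λ a b d → f a * g b * h d)                 ≡⟨ sum-cong-≗ (λ a → sum-cong-≗ λ b → *-distribˡ-sum (f a * g b) h) ⟨
  sum (λ a → sum (λ b → f a * g b * sum h))       ≡⟨ sum-cong-≗ (λ a → *-distribʳ-sum (sum h) (λ b → f a * g b)) ⟨
  sum (λ a → sum (λ b → f a * g b) * sum h)       ≡⟨ *-distribʳ-sum (sum h) (λ a → sum (λ b → f a * g b)) ⟨
  sum (λ a → sum (λ b → f a * g b)) * sum h       ≡⟨ cong (_* sum h) (sum-cong-≗ λ a → *-distribˡ-sum (f a) g) ⟨
  sum (λ a → f a * sum g) * sum h                 ≡⟨ cong (_* sum h) (*-distribʳ-sum (sum g) f) ⟨
  sum f * sum g * sum h                           ∎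
  where open ≡-Reasoning

term≤∑³ : ∀ {n} (f : Fin n → Fin n → Fin n → ℕ) a b d → f a b d ≤ ∑³ f
term≤∑³ f a b d = ≤-trans (term≤sum (f a b) d) (≤-trans (term≤sum (λ b → sum (f a b)) b)
                    (term≤sum (λ a → ∑[ b < _ ] sum (f a b)) a))

∑³-<-witness : ∀ {n} (f g : Fin n → Fin n → Fin n → ℕ) → ∑³ f < ∑³ g →
  ∃ λ a → ∃ λ b → ∃ λ d → f a b d < g a b d
∑³-<-witness {n} f g lt with sum-<-witness (λ a → ∑[ b < n ] sum (f a b)) (λ a → ∑[ b < n ] sum (g a b)) lt
... | a , lt₁ with sum-<-witness (λ b → sum (f a b)) (λ b → sum (g a b)) lt₁
... | b , lt₂ with sum-<-witness (f a b) (g a b) lt₂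
... | d , lt₃ = a , b , d , lt₃

Distinct : ∀ {A : Set} → A → A → A → Set
Distinct a b d = a ≢ b × a ≢ d × b ≢ d

distinct? : ∀ {n} (a b d : Fin n) → Dec (Distinct a b d)
distinct? a b d = ¬? (a ≟ b) ×-dec ¬? (a ≟ d) ×-dec ¬? (b ≟ d)

count-distinct : ∀ n → ∑³ (λ (a b d : Fin n) → ⟦ distinct? a b d ⟧) ≡ n * ((n ∸ 1) * (n ∸ 2))
count-distinct n = begin
  ∑³ (λ (a b d : Fin n) → ⟦ distinct? a b d ⟧)         ≡⟨ sum-cong-≗ (λ a → sum-cong-≗ (third-point a)) ⟩
  ∑[ a < n ] ∑[ b < n ] (⟦ ¬? (a ≟ b) ⟧ * (n ∸ 2))     ≡⟨ sum-cong-≗ (λ a → *-distribʳ-sum {n} (n ∸ 2) (λ b → ⟦ ¬? (a ≟ b) ⟧)) ⟨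
  ∑[ a < n ] (∑[ b < n ] ⟦ ¬? (a ≟ b) ⟧ * (n ∸ 2))     ≡⟨ sum-cong-≗ (λ a → cong (_* (n ∸ 2)) (count-≢ {n} a)) ⟩
  ∑[ a < n ] ((n ∸ 1) * (n ∸ 2))                       ≡⟨ sum-const n ((n ∸ 1) * (n ∸ 2)) ⟩
  n * ((n ∸ 1) * (n ∸ 2))                              ∎
  where
  open ≡-Reasoning
  third-point : ∀ a b → ∑[ d < n ] ⟦ distinct? a b d ⟧ ≡ ⟦ ¬? (a ≟ b) ⟧ * (n ∸ 2)
  third-point a b with a ≟ b
  ... | yes _ = trans (sum-const n 0) (*-zeroʳ n)
  ... | no a≢b = begin
    ∑[ d < n ] ⟦ ¬? (a ≟ d) ×-dec ¬? (b ≟ d) ⟧          ≡⟨ sum-cong-≗ (λ d → ⟦×⟧ (¬? (a ≟ d)) (¬? (b ≟ d))) ⟩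
    ∑[ d < n ] (⟦ ¬? (a ≟ d) ⟧ * ⟦ ¬? (b ≟ d) ⟧)         ≡⟨ count-≢₂ a≢b ⟩
    n ∸ 2                                                ≡⟨ +-identityʳ (n ∸ 2) ⟨
    1 * (n ∸ 2)                                          ∎

amgm₂-ordered : ∀ x d → 2 * (x * (x + d)) ≤ x * x + (x + d) * (x + d)
amgm₂-ordered x d = subst (2 * (x * (x + d)) ≤_) (sym (square-gap x d)) (m≤m+n _ (d * d))
  where
  square-gap : ∀ x d → x * x + (x + d) * (x + d) ≡ 2 * (x * (x + d)) + d * d
  square-gap = solve-∀

amgm₂ : ∀ x y → 2 * (x * y) ≤ x * x + y * y
amgm₂ x y with ≤-total x y
... | inj₁ x≤y = subst (λ z → 2 * (x * z) ≤ x * x + z * z) (m+[n∸m]≡n x≤y) (amgm₂-ordered x (y ∸ x))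
... | inj₂ y≤x = subst₂ _≤_ (cong (2 *_) (*-comm y x)) (+-comm (y * y) (x * x))
                   (subst (λ z → 2 * (y * z) ≤ y * y + z * z) (m+[n∸m]≡n y≤x) (amgm₂-ordered y (x ∸ y)))

-- Three-variable AM–GM, 27abc ≤ (a + b + c)³, from the two-variable one through
-- 3(ab + bc + ca) ≤ (a + b + c)²  and  9abc ≤ (a + b + c)(ab + bc + ca).
amgm₃ : ∀ a b c → 27 * (a * b * c) ≤ (a + b + c) ^ 3
amgm₃ a b c = begin
  27 * (a * b * c)                          ≡⟨ solve (a ∷ b ∷ c ∷ []) ⟩
  3 * (9 * (a * b * c))                     ≤⟨ *-monoʳ-≤ 3 product≤ ⟩
  3 * ((a + b + c) * (a * b + b * c + c * a)) ≡⟨ solve (a ∷ b ∷ c ∷ []) ⟩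
  (a + b + c) * (3 * (a * b + b * c + c * a)) ≤⟨ *-monoʳ-≤ (a + b + c) pairs≤ ⟩
  (a + b + c) * ((a + b + c) * (a + b + c)) ≡⟨ cong (λ x → (a + b + c) * ((a + b + c) * x)) (*-identityʳ (a + b + c)) ⟨
  (a + b + c) ^ 3                           ∎
  where
  open ≤-Reasoning
  pairs≤squares : a * b + b * c + c * a ≤ a * a + b * b + c * c
  pairs≤squares = *-cancelˡ-≤ 2 (begin
    2 * (a * b + b * c + c * a)                           ≡⟨ solve (a ∷ b ∷ c ∷ []) ⟩
    2 * (a * b) + 2 * (b * c) + 2 * (c * a)               ≤⟨ +-mono-≤ (+-mono-≤ (amgm₂ a b) (amgm₂ b c)) (amgm₂ c a) ⟩
    (a * a + b * b) + (b * b + c * c) + (c * c + a * a)   ≡⟨ solve (a ∷ b ∷ c ∷ []) ⟩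
    2 * (a * a + b * b + c * c)                           ∎)

  pairs≤ : 3 * (a * b + b * c + c * a) ≤ (a + b + c) * (a + b + c)
  pairs≤ = begin
    3 * (a * b + b * c + c * a)                               ≡⟨ solve (a ∷ b ∷ c ∷ []) ⟩
    (a * b + b * c + c * a) + 2 * (a * b + b * c + c * a)     ≤⟨ +-monoˡ-≤ (2 * (a * b + b * c + c * a)) pairs≤squares ⟩
    (a * a + b * b + c * c) + 2 * (a * b + b * c + c * a)     ≡⟨ solve (a ∷ b ∷ c ∷ []) ⟩
    (a + b + c) * (a + b + c)                                 ∎

  product≤ : 9 * (a * b * c) ≤ (a + b + c) * (a * b + b * c + c * a)
  product≤ = begin
    9 * (a * b * c)                                                       ≡⟨ solve (a ∷ b ∷ c ∷ []) ⟩
    3 * (a * b * c) + (c * (2 * (a * b)) + a * (2 * (b * c)) + b * (2 * (c * a)))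
      ≤⟨ +-monoʳ-≤ (3 * (a * b * c)) (+-mono-≤ (+-mono-≤ (*-monoʳ-≤ c (amgm₂ a b)) (*-monoʳ-≤ a (amgm₂ b c))) (*-monoʳ-≤ b (amgm₂ c a))) ⟩
    3 * (a * b * c) + (c * (a * a + b * b) + a * (b * b + c * c) + b * (c * c + a * a))
      ≡⟨ solve (a ∷ b ∷ c ∷ []) ⟩
    (a + b + c) * (a * b + b * c + c * a)                                 ∎

-- Among the 27 triples of colours, the distinct ones are the 3! orderings of the
-- three colours.
six-orderings : ∀ (v : Fin 3 → ℕ) →
  ∑³ (λ k₁ k₂ k₃ → ⟦ distinct? k₁ k₂ k₃ ⟧ * (v k₁ * v k₂ * v k₃)) ≡ 6 * (v zero * v (suc zero) * v (suc (suc zero)))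
six-orderings v = orderings (v zero) (v (suc zero)) (v (suc (suc zero)))
  where
  -- the left-hand side evaluates to this sum of the six orderings (the zeros come
  -- from the non-distinct triples and from the ends of the nested sums)
  orderings : ∀ p q r →
    p * q * r + 0 + 0 + (p * r * q + 0 + 0 + 0) +
    (q * p * r + 0 + 0 + (q * r * p + 0 + 0 + 0) + (r * p * q + 0 + 0 + (r * q * p + 0 + 0 + 0) + 0))
    ≡ 6 * (p * q * r)
  orderings = solve-∀

⟦⟧-below : ∀ {p} {P : Set p} {x B} (P? : Dec P) → x < ⟦ P? ⟧ * suc B → P × x ≤ B
⟦⟧-below {B = B} (yes p) (s≤s x≤) = p , subst (_ ≤_) (+-identityʳ B) x≤
⟦⟧-below (no _) ()

module Centres {n : ℕ} (c : Coloring n) where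

  -- The colour of the unordered edge {x, y}: c is read in increasing vertex order.
  col : Fin n → Fin n → Fin 3
  col x y with x ≤ᶠ? y
  ... | yes _ = c x y
  ... | no _ = c y x

  col-sym : ∀ x y → col x y ≡ col y x
  col-sym x y with x ≤ᶠ? y | y ≤ᶠ? x
  ... | yes x≤y | yes y≤x = let x≡y = ≤ᶠ-antisym x≤y y≤x in cong₂ c x≡y (sym x≡y)
  ... | yes _ | no _ = refl
  ... | no _ | yes _ = refl
  ... | no x≰y | no y≰x with ≤ᶠ-total x y
  ...   | inj₁ x≤y = contradiction x≤y x≰y
  ...   | inj₂ y≤x = contradiction y≤x y≰x

  col-increasing : ∀ {x y} → x <ᶠ y → col x y ≡ c x y
  col-increasing {x} {y} x<y with x ≤ᶠ? y
  ... | yes _ = refl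
  ... | no x≰y = contradiction (<⇒≤ x<y) x≰y

  sees : Fin n → Fin 3 → Fin n → ℕ
  sees x k y = ⟦ ¬? (x ≟ y) ⟧ * ⟦ col x y ≟ k ⟧

  sees-own-colour : ∀ {x y} → x ≢ y → sees x (col x y) y ≡ 1
  sees-own-colour {x} {y} x≢y = cong₂ _*_ (⟦⟧-yes (¬? (x ≟ y)) x≢y) (⟦⟧-yes (col x y ≟ col x y) refl)

  degree : Fin n → Fin 3 → ℕ
  degree x k = ∑[ y < n ] sees x k y

  -- centre x a b d is 1 if x ∉ {a, b, d} and the edges xa, xb, xd have three
  -- distinct colours (x is the centre of a rainbow star on a, b, d), and 0 otherwise.
  centre : Fin n → Fin n → Fin n → Fin n → ℕ
  centre x a b d = ∑³ (λ k₁ k₂ k₃ → ⟦ distinct? k₁ k₂ k₃ ⟧ * (sees x k₁ a * sees x k₂ b * sees x k₃ d))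

  rainbowCentres : Fin n → Fin n → Fin n → ℕ
  rainbowCentres a b d = ∑[ x < n ] centre x a b d

  -- Every y ≠ x is a neighbour of x in exactly one colour.
  degree-sum : ∀ x → degree x zero + degree x (suc zero) + degree x (suc (suc zero)) ≡ n ∸ 1
  degree-sum x = begin
    degree x zero + degree x (suc zero) + degree x (suc (suc zero))      ≡⟨ +-assoc (degree x zero) _ _ ⟩
    degree x zero + (degree x (suc zero) + degree x (suc (suc zero)))    ≡⟨ cong (λ z → degree x zero + (degree x (suc zero) + z)) (+-identityʳ _) ⟨
    ∑[ k < 3 ] ∑[ y < n ] sees x k y                                      ≡⟨ ∑-comm (λ y k → sees x k y) ⟨
    ∑[ y < n ] ∑[ k < 3 ] sees x k y                                      ≡⟨ sum-cong-≗ one-colour ⟩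
    ∑[ y < n ] ⟦ ¬? (x ≟ y) ⟧                                             ≡⟨ count-≢ x ⟩
    n ∸ 1                                                                 ∎
    where
    open ≡-Reasoning
    one-colour : ∀ y → ∑[ k < 3 ] sees x k y ≡ ⟦ ¬? (x ≟ y) ⟧
    one-colour y = trans (sym (*-distribˡ-sum ⟦ ¬? (x ≟ y) ⟧ (λ k → ⟦ col x y ≟ k ⟧)))
                         (trans (cong (⟦ ¬? (x ≟ y) ⟧ *_) (count-≡ (col x y))) (*-identityʳ _))

  centres-at : ∀ x → ∑³ (centre x) ≡ 6 * (degree x zero * degree x (suc zero) * degree x (suc (suc zero)))
  centres-at x = begin
    ∑³ (centre x)
      ≡⟨ ∑³-swap (λ k₁ k₂ k₃ a b d → ⟦ distinct? k₁ k₂ k₃ ⟧ * (sees x k₁ a * sees x k₂ b * sees x k₃ d)) ⟩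
    ∑³ (λ k₁ k₂ k₃ → ∑³ (λ a b d → ⟦ distinct? k₁ k₂ k₃ ⟧ * (sees x k₁ a * sees x k₂ b * sees x k₃ d)))
      ≡⟨ ∑³-cong (λ k₁ k₂ k₃ → ∑³-*ˡ ⟦ distinct? k₁ k₂ k₃ ⟧ (λ a b d → sees x k₁ a * sees x k₂ b * sees x k₃ d)) ⟩
    ∑³ (λ k₁ k₂ k₃ → ⟦ distinct? k₁ k₂ k₃ ⟧ * ∑³ (λ a b d → sees x k₁ a * sees x k₂ b * sees x k₃ d))
      ≡⟨ ∑³-cong (λ k₁ k₂ k₃ → cong (⟦ distinct? k₁ k₂ k₃ ⟧ *_) (∑³-product (sees x k₁) (sees x k₂) (sees x k₃))) ⟩
    ∑³ (λ k₁ k₂ k₃ → ⟦ distinct? k₁ k₂ k₃ ⟧ * (degree x k₁ * degree x k₂ * degree x k₃))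
      ≡⟨ six-orderings (degree x) ⟩
    6 * (degree x zero * degree x (suc zero) * degree x (suc (suc zero)))   ∎
    where open ≡-Reasoning

  -- By AM–GM, since the three degrees add up to n - 1.
  centres-at-bound : ∀ x → 9 * ∑³ (centre x) ≤ 2 * (n ∸ 1) ^ 3
  centres-at-bound x = begin
    9 * ∑³ (centre x)              ≡⟨ cong (9 *_) (centres-at x) ⟩
    9 * (6 * (d₀ * d₁ * d₂))       ≡⟨ 54=2·27 (d₀ * d₁ * d₂) ⟩
    2 * (27 * (d₀ * d₁ * d₂))      ≤⟨ *-monoʳ-≤ 2 (amgm₃ d₀ d₁ d₂) ⟩
    2 * (d₀ + d₁ + d₂) ^ 3         ≡⟨ cong (λ m → 2 * m ^ 3) (degree-sum x) ⟩
    2 * (n ∸ 1) ^ 3                ∎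
    where
    open ≤-Reasoning
    d₀ d₁ d₂ : ℕ
    d₀ = degree x zero
    d₁ = degree x (suc zero)
    d₂ = degree x (suc (suc zero))
    54=2·27 : ∀ p → 9 * (6 * p) ≡ 2 * (27 * p)
    54=2·27 = solve-∀

  total-centres : 9 * ∑³ rainbowCentres ≤ n * (2 * (n ∸ 1) ^ 3)
  total-centres = begin
    9 * ∑³ rainbowCentres               ≡⟨ cong (9 *_) (∑³-comm centre) ⟩
    9 * ∑[ x < n ] ∑³ (centre x)        ≡⟨ *-distribˡ-sum 9 (λ x → ∑³ (centre x)) ⟩
    ∑[ x < n ] (9 * ∑³ (centre x))      ≤⟨ sum-mono-≤ centres-at-bound ⟩
    ∑[ x < n ] (2 * (n ∸ 1) ^ 3)        ≡⟨ sum-const n _ ⟩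
    n * (2 * (n ∸ 1) ^ 3)               ∎
    where open ≤-Reasoning

  averaging : ∀ M B → M * ∑³ rainbowCentres < ∑³ (λ (a b d : Fin n) → ⟦ distinct? a b d ⟧) * suc B →
    ∃ λ a → ∃ λ b → ∃ λ d → Distinct a b d × M * rainbowCentres a b d ≤ B
  averaging M B lt = pick (∑³-<-witness (λ a b d → M * rainbowCentres a b d) (λ a b d → ⟦ distinct? a b d ⟧ * suc B)
    (subst₂ _<_ (sym (∑³-*ˡ M rainbowCentres)) (sym (∑³-*ʳ (suc B) (λ (a b d : Fin n) → ⟦ distinct? a b d ⟧))) lt))
    where
    pick : (∃ λ a → ∃ λ b → ∃ λ d → M * rainbowCentres a b d < ⟦ distinct? a b d ⟧ * suc B) →
      ∃ λ a → ∃ λ b → ∃ λ d → Distinct a b d × M * rainbowCentres a b d ≤ B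
    pick (a , b , d , lt) = a , b , d , ⟦⟧-below (distinct? a b d) lt

opaque
  few-centres : ∀ k (c : Coloring (3 + k)) → ∃ λ a → ∃ λ b → ∃ λ d →
    Distinct a b d × 9 * suc k * Centres.rainbowCentres c a b d ≤ 2 * suc (suc k) ^ 2
  few-centres k c = averaging (9 * suc k) B (begin-strict
      9 * suc k * ∑³ rainbowCentres                  ≡⟨ swap-factors (suc k) (∑³ rainbowCentres) ⟩
      suc k * (9 * ∑³ rainbowCentres)                ≤⟨ *-monoʳ-≤ (suc k) total-centres ⟩
      suc k * (n * (2 * suc (suc k) ^ 3))            ≡⟨ rearrange k ⟩
      n * (suc (suc k) * suc k) * B                  <⟨ *-monoʳ-< (n * (suc (suc k) * suc k)) (n<1+n B) ⟩
      n * (suc (suc k) * suc k) * suc B              ≡⟨ cong (_* suc B) (count-distinct n) ⟨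
      ∑³ (λ (a b d : Fin n) → ⟦ distinct? a b d ⟧) * suc B     ∎)
    where
    open Centres c
    open ≤-Reasoning
    n B : ℕ
    n = 3 + k
    B = 2 * suc (suc k) ^ 2
    swap-factors : ∀ p x → 9 * p * x ≡ p * (9 * x)
    swap-factors = solve-∀
    rearrange : ∀ k → (1 + k) * ((3 + k) * (2 * ((2 + k) * ((2 + k) * ((2 + k) * 1)))))
                    ≡ (3 + k) * ((2 + k) * (1 + k)) * (2 * ((2 + k) * ((2 + k) * 1)))
    rearrange = solve-∀

does-true : ∀ {p} {P : Set p} (P? : Dec P) → does P? ≡ true → P
does-true (yes p) _ = p

image : ∀ {m n} → (Fin m → Fin n) → Subset n
image s = Vec.tabulate (λ x → does (any? λ i → s i ≟ x))

∈-image⁺ : ∀ {m n} {s : Fin m → Fin n} i → s i ∈ₛ image s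
∈-image⁺ {s = s} i = lookup⇒[]= (s i) (image s)
  (trans (lookup∘tabulate _ (s i)) (dec-true (any? λ j → s j ≟ s i) (i , refl)))

∈-image⁻ : ∀ {m n} {s : Fin m → Fin n} {x} → x ∈ₛ image s → ∃ λ i → s i ≡ x
∈-image⁻ {s = s} {x} x∈ =
  does-true (any? λ i → s i ≟ x) (trans (sym (lookup∘tabulate _ x)) ([]=⇒lookup x∈))

∣tabulate∣ : ∀ {n} (f : Fin n → Bool) → ∣ Vec.tabulate f ∣ ≡ ∑[ x < n ] (if f x then 1 else 0)
∣tabulate∣ {zero} f = refl
∣tabulate∣ {suc n} f with f zero
... | true = cong suc (∣tabulate∣ (f ∘ suc))
... | false = ∣tabulate∣ (f ∘ suc)

⟦∈image⟧ : ∀ {m n} (s : Fin m → Fin n) → Injective _≡_ _≡_ s → ∀ x →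
  ⟦ any? (λ i → s i ≟ x) ⟧ ≡ ∑[ i < m ] ⟦ s i ≟ x ⟧
⟦∈image⟧ {zero} s s-inj x = refl
⟦∈image⟧ {suc m} s s-inj x with s zero ≟ x
... | no _ = ⟦∈image⟧ (s ∘ suc) (suc-injective ∘ s-inj) x
... | yes s₀≡x = cong suc (sym (trans (sum-cong-≗ none-other) (trans (sum-const m 0) (*-zeroʳ m))))
  where
  none-other : ∀ i → ⟦ s (suc i) ≟ x ⟧ ≡ 0
  none-other i with s (suc i) ≟ x
  ... | yes sᵢ≡x = contradiction (s-inj (trans sᵢ≡x (sym s₀≡x))) λ ()
  ... | no _ = refl

∣image∣ : ∀ {m n} (s : Fin m → Fin n) → Injective _≡_ _≡_ s → ∣ image s ∣ ≡ m
∣image∣ {m} {n} s s-inj = begin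
  ∣ image s ∣                           ≡⟨ ∣tabulate∣ (λ x → does (any? λ i → s i ≟ x)) ⟩
  ∑[ x < n ] ⟦ any? (λ i → s i ≟ x) ⟧   ≡⟨ sum-cong-≗ (⟦∈image⟧ s s-inj) ⟩
  ∑[ x < n ] ∑[ i < m ] ⟦ s i ≟ x ⟧     ≡⟨ ∑-comm (λ x i → ⟦ s i ≟ x ⟧) ⟩
  ∑[ i < m ] ∑[ x < n ] ⟦ s i ≟ x ⟧     ≡⟨ sum-cong-≗ (λ i → count-≡ (s i)) ⟩
  ∑[ i < m ] 1                           ≡⟨ trans (sum-const m 1) (*-identityʳ m) ⟩
  m                                      ∎
  where
  open ≡-Reasoning

rainbow-injective : ∀ {A B : Set} {C : A → B} {xs x y} → AllPairs (λ e f → C e ≢ C f) xs →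
  x ∈ xs → y ∈ xs → C x ≡ C y → x ≡ y
rainbow-injective (_ ∷ _) (Any.here refl) (Any.here refl) _ = refl
rainbow-injective (x≁ ∷ _) (Any.here refl) (Any.there y∈) Cx≡Cy = contradiction Cx≡Cy (All.lookup x≁ y∈)
rainbow-injective (y≁ ∷ _) (Any.there x∈) (Any.here refl) Cx≡Cy = contradiction (sym Cx≡Cy) (All.lookup y≁ x∈)
rainbow-injective (_ ∷ rest) (Any.there x∈) (Any.there y∈) Cx≡Cy = rainbow-injective rest x∈ y∈ Cx≡Cy

walk-preserves : ∀ {n} {E : List (Edge n)} (K : Fin n → Set) →
  (∀ {u v} → Adj E u v → K u → K v) → ∀ {u v} → Walk E u v → K u → K v
walk-preserves K passes here Ku = Ku
walk-preserves K passes (step uw w⇝v) Ku = walk-preserves K passes w⇝v (passes uw Ku)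

walk-leaves : ∀ {n} {E : List (Edge n)} {u v} → Walk E u v → u ≢ v → ∃ λ w → Adj E u w
walk-leaves here u≢u = contradiction refl u≢u
walk-leaves (step uw _) _ = _ , uw

Joins : ∀ {n} → Edge n → Fin n → Fin n → Set
Joins e u v = e ≡ (u , v) ⊎ e ≡ (v , u)

adj-edge : ∀ {n} {E : List (Edge n)} {u v} → Adj E u v → ∃ λ e → e ∈ E × Joins e u v
adj-edge (inj₁ uv∈) = _ , uv∈ , inj₁ refl
adj-edge (inj₂ vu∈) = _ , vu∈ , inj₂ refl

joins-unique : ∀ {n} {e : Edge n} {u v x y} → Joins e u v → Joins e x y → (u ≡ x × v ≡ y) ⊎ (u ≡ y × v ≡ x)
joins-unique (inj₁ refl) (inj₁ refl) = inj₁ (refl , refl)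
joins-unique (inj₁ refl) (inj₂ refl) = inj₂ (refl , refl)
joins-unique (inj₂ refl) (inj₁ refl) = inj₂ (refl , refl)
joins-unique (inj₂ refl) (inj₂ refl) = inj₁ (refl , refl)

support : ∀ {n} → (Fin n → ℕ) → List (Fin n)
support {zero} g = []
support {suc n} g with g zero
... | zero = map suc (support (g ∘ suc))
... | suc _ = zero ∷ map suc (support (g ∘ suc))

length-support : ∀ {n} (g : Fin n → ℕ) → length (support g) ≤ sum g
length-support {zero} g = z≤n
length-support {suc n} g with g zero
... | zero = subst (_≤ sum (g ∘ suc)) (sym (length-map suc (support (g ∘ suc)))) (length-support (g ∘ suc))
... | suc w = s≤s (≤-trans (subst (_≤ sum (g ∘ suc)) (sym (length-map suc (support (g ∘ suc)))) (length-support (g ∘ suc)))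
                           (m≤n+m _ w))

∈-support : ∀ {n} (g : Fin n → ℕ) {x} → 1 ≤ g x → x ∈ support g
∈-support {suc n} g {zero} g₀≥1 with g zero
... | suc _ = Any.here refl
∈-support {suc n} g {suc x} gₓ≥1 with g zero
... | zero = ∈-map⁺ suc (∈-support (g ∘ suc) gₓ≥1)
... | suc _ = Any.there (∈-map⁺ suc (∈-support (g ∘ suc) gₓ≥1))

count-by-codes : ∀ {m k n} (g : Fin n → ℕ) (h : Fin m → Fin k ⊎ Fin n) → Injective _≡_ _≡_ h →
  (∀ i x → h i ≡ inj₂ x → 1 ≤ g x) → m ≤ k + sum g
count-by-codes {m} {k} g h h-inj positive =
  ≤-trans (injective⇒≤ index-injective) (subst (_≤ k + sum g) (sym length-codes) (+-monoʳ-≤ k (length-support g)))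
  where
  codes : List (Fin k ⊎ Fin _)
  codes = map inj₁ (allFin k) ++ map inj₂ (support g)
  length-codes : length codes ≡ k + length (support g)
  length-codes = trans (length-++ (map inj₁ (allFin k)))
    (cong₂ _+_ (trans (length-map inj₁ (allFin k)) (length-tabulate {n = k} (λ i → i))) (length-map inj₂ (support g)))
  coded : ∀ i → h i ∈ codes
  coded i with h i in eq
  ... | inj₁ a = ∈-++⁺ˡ (∈-map⁺ inj₁ (∈-allFin a))
  ... | inj₂ x = ∈-++⁺ʳ (map inj₁ (allFin k)) (∈-map⁺ inj₂ (∈-support g (positive i x eq)))
  index-injective : Injective _≡_ _≡_ (λ i → Any.index (coded i))
  index-injective {i} {j} eq = h-inj (trans (lookup-index (coded i))
    (trans (cong (lookup codes) eq) (sym (lookup-index (coded j)))))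

three-colours : ∀ (p q r k : Fin 3) → p ≢ q → p ≢ r → q ≢ r → k ≡ p ⊎ k ≡ q ⊎ k ≡ r
three-colours = toWitness {a? = all? λ p → all? λ q → all? λ r → all? λ k →
  ¬? (p ≟ q) →-dec ¬? (p ≟ r) →-dec ¬? (q ≟ r) →-dec (k ≟ p ⊎-dec k ≟ q ⊎-dec k ≟ r)} _

-- The element of Fin 3 other than i and j (for i ≢ j; the other values are irrelevant).
third : Fin 3 → Fin 3 → Fin 3
third zero (suc zero) = suc (suc zero)
third (suc zero) zero = suc (suc zero)
third zero (suc (suc zero)) = suc zero
third (suc (suc zero)) zero = suc zero
third _ _ = zero

third-determines : ∀ (i j i′ j′ : Fin 3) → i ≢ j → i′ ≢ j′ → third i j ≡ third i′ j′ →
  (i ≡ i′ × j ≡ j′) ⊎ (i ≡ j′ × j ≡ i′)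
third-determines = toWitness {a? = all? λ i → all? λ j → all? λ i′ → all? λ j′ →
  ¬? (i ≟ j) →-dec ¬? (i′ ≟ j′) →-dec third i j ≟ third i′ j′ →-dec
  ((i ≟ i′ ×-dec j ≟ j′) ⊎-dec (i ≟ j′ ×-dec j ≟ i′))} _

triple : ∀ {A : Set} → A → A → A → Fin 3 → A
triple a b d zero = a
triple a b d (suc zero) = b
triple a b d (suc (suc zero)) = d

triple-injective : ∀ {A : Set} {a b d : A} → Distinct a b d → Injective _≡_ _≡_ (triple a b d)
triple-injective _ {zero} {zero} _ = refl
triple-injective (a≢b , _ , _) {zero} {suc zero} a≡b = contradiction a≡b a≢b
triple-injective (_ , a≢d , _) {zero} {suc (suc zero)} a≡d = contradiction a≡d a≢d
triple-injective (a≢b , _ , _) {suc zero} {zero} b≡a = contradiction (sym b≡a) a≢b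
triple-injective _ {suc zero} {suc zero} _ = refl
triple-injective (_ , _ , b≢d) {suc zero} {suc (suc zero)} b≡d = contradiction b≡d b≢d
triple-injective (_ , a≢d , _) {suc (suc zero)} {zero} d≡a = contradiction (sym d≡a) a≢d
triple-injective (_ , _ , b≢d) {suc (suc zero)} {suc zero} d≡b = contradiction (sym d≡b) b≢d
triple-injective _ {suc (suc zero)} {suc (suc zero)} _ = refl

module TreeShape {n : ℕ} (c : Coloring n) {a b d : Fin n} (distinct : Distinct a b d) where
  open Centres c

  s : Fin 3 → Fin n
  s = triple a b d

  s-inj : Injective _≡_ _≡_ s
  s-inj = triple-injective distinct

  S : Subset n
  S = image s

  ∣S∣≡3 : ∣ S ∣ ≡ 3
  ∣S∣≡3 = ∣image∣ s s-inj

  s∈S : ∀ i → s i ∈ₛ S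
  s∈S = ∈-image⁺ {s = s}

  ∈S⇒s : ∀ {x} → x ∈ₛ S → ∃ λ i → s i ≡ x
  ∈S⇒s = ∈-image⁻ {s = s}

  InnerEdge : Subgraph n → Set
  InnerEdge T = Σ (Fin 3) λ i → Σ (Fin 3) λ j → i ≢ j × (s i , s j) ∈ E T

  StarCentre : Subgraph n → Set
  StarCentre T = Σ (Fin n) λ x → x ∈ₛ V T × (∀ i → s i ≢ x) ×
    Distinct (col x a) (col x b) (col x d)

  other : Fin 3 → Fin 3
  other zero = suc zero
  other (suc _) = zero

  other-≢ : ∀ i → i ≢ other i
  other-≢ zero ()
  other-≢ (suc _) ()

  edge-colour : ∀ {e u v} → proj₁ e <ᶠ proj₂ e → Joins e u v → colour c e ≡ col u v
  edge-colour u<v (inj₁ refl) = sym (col-increasing u<v)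
  edge-colour {u = u} {v} v<u (inj₂ refl) = trans (sym (col-increasing v<u)) (col-sym v u)

  -- A rainbow S-tree without inner edges is a star: each s i has a neighbour hub i,
  -- the three spokes s i – hub i have distinct colours and hence are all the edges
  -- of T, and connectivity forces the hubs to coincide.
  module Spokes (T : Subgraph n) (rt : RainbowSTree c S T)
                (no-inner : ∀ {u v} → Adj (E T) u v → u ∈ₛ S → v ∈ₛ S → ⊥) where

    well-formed : WellFormed T
    well-formed = proj₁ (proj₁ rt)

    connected : IsConnected T
    connected = proj₁ (proj₂ (proj₁ rt))

    rainbow : Rainbow c T
    rainbow = proj₁ (proj₂ rt)

    s∈T : ∀ i → s i ∈ₛ V T
    s∈T i = proj₂ (proj₂ rt) (s∈S i)

    s-neighbour : ∀ i → ∃ λ w → Adj (E T) (s i) w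
    s-neighbour i = walk-leaves (connected (s i) (s (other i)) (s∈T i) (s∈T (other i))) (other-≢ i ∘ s-inj)

    hub : Fin 3 → Fin n
    hub i = proj₁ (s-neighbour i)

    spoke : ∀ i → Adj (E T) (s i) (hub i)
    spoke i = proj₂ (s-neighbour i)

    hub∉S : ∀ i j → s j ≢ hub i
    hub∉S i j sⱼ≡hubᵢ = no-inner (spoke i) (s∈S i) (subst (_∈ₛ S) sⱼ≡hubᵢ (s∈S j))

    edge : Fin 3 → Edge n
    edge i = proj₁ (adj-edge (spoke i))

    edge∈T : ∀ i → edge i ∈ E T
    edge∈T i = proj₁ (proj₂ (adj-edge (spoke i)))

    edge-joins : ∀ i → Joins (edge i) (s i) (hub i)
    edge-joins i = proj₂ (proj₂ (adj-edge (spoke i)))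

    spoke-colour : Fin 3 → Fin 3
    spoke-colour i = col (hub i) (s i)

    colour-edge : ∀ i → colour c (edge i) ≡ spoke-colour i
    colour-edge i = trans (edge-colour (proj₁ (proj₂ well-formed (edge i) (edge∈T i))) (edge-joins i)) (col-sym (s i) (hub i))

    edges-differ : ∀ {i j} → edge i ≡ edge j → i ≡ j
    edges-differ {i} {j} eq with joins-unique (edge-joins i) (subst (λ e → Joins e (s j) (hub j)) (sym eq) (edge-joins j))
    ... | inj₁ (sᵢ≡sⱼ , _) = s-inj sᵢ≡sⱼ
    ... | inj₂ (sᵢ≡hubⱼ , _) = contradiction sᵢ≡hubⱼ (hub∉S j i)

    spoke-colours-differ : ∀ i j → i ≢ j → spoke-colour i ≢ spoke-colour j
    spoke-colours-differ i j i≢j same = i≢j (edges-differ (rainbow-injective rainbow (edge∈T i) (edge∈T j)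
      (trans (colour-edge i) (trans same (sym (colour-edge j))))))

    -- The spokes use up all three colours, so T has no other edges.
    only-spokes : ∀ {e} → e ∈ E T → ∃ λ i → e ≡ edge i
    only-spokes {e} e∈T = spoke-of (three-colours (spoke-colour zero) (spoke-colour one) (spoke-colour two) (colour c e)
      (spoke-colours-differ zero one λ ()) (spoke-colours-differ zero two λ ()) (spoke-colours-differ one two λ ()))
      where
      one two : Fin 3
      one = suc zero
      two = suc (suc zero)
      coloured-as : ∀ i → colour c e ≡ spoke-colour i → e ≡ edge i
      coloured-as i same = rainbow-injective rainbow e∈T (edge∈T i) (trans same (sym (colour-edge i)))
      spoke-of : colour c e ≡ spoke-colour zero ⊎ colour c e ≡ spoke-colour one ⊎ colour c e ≡ spoke-colour two →
        ∃ λ i → e ≡ edge i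
      spoke-of (inj₁ same) = zero , coloured-as zero same
      spoke-of (inj₂ (inj₁ same)) = one , coloured-as one same
      spoke-of (inj₂ (inj₂ same)) = two , coloured-as two same

    adj-spoke : ∀ {u v} → Adj (E T) u v → ∃ λ i → (u ≡ s i × v ≡ hub i) ⊎ (u ≡ hub i × v ≡ s i)
    adj-spoke {u} {v} uv = spoke-through (adj-edge uv)
      where
      spoke-through : (∃ λ e → e ∈ E T × Joins e u v) → ∃ λ i → (u ≡ s i × v ≡ hub i) ⊎ (u ≡ hub i × v ≡ s i)
      spoke-through (e , e∈T , e-joins) =
        let (i , e≡edgeᵢ) = only-spokes e∈T
        in i , joins-unique e-joins (subst (λ f → Joins f (s i) (hub i)) (sym e≡edgeᵢ) (edge-joins i))

    -- Walking along T one is always at hub 0, or at some s i with hub i = hub 0.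
    AtHub : Fin n → Set
    AtHub v = v ≡ hub zero ⊎ ∃ λ i → v ≡ s i × hub i ≡ hub zero

    at-hub-along : ∀ {u v} → (∃ λ i → (u ≡ s i × v ≡ hub i) ⊎ (u ≡ hub i × v ≡ s i)) → AtHub u → AtHub v
    at-hub-along (i , inj₁ (refl , refl)) (inj₁ sᵢ≡hub₀) = contradiction sᵢ≡hub₀ (hub∉S zero i)
    at-hub-along (i , inj₁ (refl , refl)) (inj₂ (j , sᵢ≡sⱼ , hubⱼ≡hub₀)) = inj₁ (trans (cong hub (s-inj sᵢ≡sⱼ)) hubⱼ≡hub₀)
    at-hub-along (i , inj₂ (refl , refl)) (inj₁ hubᵢ≡hub₀) = inj₂ (i , refl , hubᵢ≡hub₀)
    at-hub-along (i , inj₂ (refl , refl)) (inj₂ (j , hubᵢ≡sⱼ , _)) = contradiction (sym hubᵢ≡sⱼ) (hub∉S i j)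

    at-hub-s : ∀ k → AtHub (s k) → hub k ≡ hub zero
    at-hub-s k (inj₁ sₖ≡hub₀) = contradiction sₖ≡hub₀ (hub∉S zero k)
    at-hub-s k (inj₂ (j , sₖ≡sⱼ , hubⱼ≡hub₀)) = trans (cong hub (s-inj sₖ≡sⱼ)) hubⱼ≡hub₀

    common-hub : ∀ k → hub k ≡ hub zero
    common-hub k = at-hub-s k (walk-preserves AtHub (at-hub-along ∘ adj-spoke)
      (connected (s zero) (s k) (s∈T zero) (s∈T k)) (inj₂ (zero , refl , refl)))

    ends∈T : ∀ {e u v} → e ∈ E T → Joins e u v → u ∈ₛ V T × v ∈ₛ V T
    ends∈T e∈T (inj₁ refl) = proj₂ (proj₂ well-formed _ e∈T)
    ends∈T e∈T (inj₂ refl) = let (v∈ , u∈) = proj₂ (proj₂ well-formed _ e∈T) in u∈ , v∈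

    hub∈T : hub zero ∈ₛ V T
    hub∈T = proj₂ (ends∈T (edge∈T zero) (edge-joins zero))

    star : StarCentre T
    star = hub zero , hub∈T , hub∉S zero ,
           differ zero (suc zero) (λ ()) , differ zero (suc (suc zero)) (λ ()) , differ (suc zero) (suc (suc zero)) (λ ())
      where
      differ : ∀ i j → i ≢ j → col (hub zero) (s i) ≢ col (hub zero) (s j)
      differ i j i≢j same = spoke-colours-differ i j i≢j
        (trans (cong (λ h → col h (s i)) (common-hub i)) (trans same (cong (λ h → col h (s j)) (sym (common-hub j)))))

  Shape : Subgraph n → Set
  Shape T = InnerEdge T ⊎ StarCentre T

  classify : ∀ T → RainbowSTree c S T → Shape T
  classify T rt with Any.any? (λ e → proj₁ e ∈? S ×-dec proj₂ e ∈? S) (E T)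
  ... | yes inner = inj₁ (inner-edge (find inner))
    where
    inner-edge : (∃ λ e → e ∈ E T × (proj₁ e ∈ₛ S × proj₂ e ∈ₛ S)) → InnerEdge T
    inner-edge ((u , v) , uv∈T , u∈S , v∈S) with ∈S⇒s u∈S | ∈S⇒s v∈S
    ... | i , refl | j , refl = i , j , (λ { refl → <-irrefl refl (proj₁ (proj₂ (proj₁ (proj₁ rt)) _ uv∈T)) }) , uv∈T
  ... | no none = inj₂ (Spokes.star T rt no-inner)
    where
    no-inner : ∀ {u v} → Adj (E T) u v → u ∈ₛ S → v ∈ₛ S → ⊥
    no-inner (inj₁ uv∈T) u∈S v∈S = none (lose uv∈T (u∈S , v∈S))
    no-inner (inj₂ vu∈T) u∈S v∈S = none (lose vu∈T (v∈S , u∈S))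

  -- Code a tree by the vertex of S off its inner edge, or by its star centre.
  code : ∀ {T} → Shape T → Fin 3 ⊎ Fin n
  code (inj₁ (i , j , _)) = inj₁ (third i j)
  code (inj₂ (x , _)) = inj₂ x

  -- Internally disjoint trees get different codes: they cannot share an inner
  -- edge (in either orientation), nor a star centre outside S.
  codes-differ : ∀ {T₁ T₂} → WellFormed T₁ → WellFormed T₂ → InternallyDisjoint S T₁ T₂ →
    (r₁ : Shape T₁) (r₂ : Shape T₂) → code r₁ ≢ code r₂
  codes-differ wf₁ wf₂ (edge-disjoint , _) (inj₁ (i , j , i≢j , ij∈T₁)) (inj₁ (i′ , j′ , i′≢j′ , ij∈T₂)) same
    with third-determines i j i′ j′ i≢j i′≢j′ (inj₁-injective same)
  ... | inj₁ (refl , refl) = edge-disjoint _ ij∈T₁ ij∈T₂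
  ... | inj₂ (refl , refl) = <-asym (proj₁ (proj₂ wf₁ _ ij∈T₁)) (proj₁ (proj₂ wf₂ _ ij∈T₂))
  codes-differ _ _ (_ , shared∈S) (inj₂ (x , x∈T₁ , x∉S , _)) (inj₂ (_ , x∈T₂ , _)) refl =
    let (i , sᵢ≡x) = ∈S⇒s (shared∈S x x∈T₁ x∈T₂) in x∉S i sᵢ≡x
  codes-differ _ _ _ (inj₁ _) (inj₂ _) ()
  codes-differ _ _ _ (inj₂ _) (inj₁ _) ()

  centre-counted : ∀ {T} (r : StarCentre T) → 1 ≤ centre (proj₁ r) a b d
  centre-counted (x , _ , x∉S , colours-differ) =
    subst (_≤ centre x a b d) its-term (term≤∑³ (λ k₁ k₂ k₃ → ⟦ distinct? k₁ k₂ k₃ ⟧ * (sees x k₁ a * sees x k₂ b * sees x k₃ d))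
      (col x a) (col x b) (col x d))
    where
    its-term : ⟦ distinct? (col x a) (col x b) (col x d) ⟧ * (sees x (col x a) a * sees x (col x b) b * sees x (col x d) d) ≡ 1
    its-term = cong₂ _*_ (⟦⟧-yes (distinct? (col x a) (col x b) (col x d)) colours-differ)
      (cong₂ _*_ (cong₂ _*_ (sees-own-colour (x∉S zero ∘ sym)) (sees-own-colour (x∉S (suc zero) ∘ sym)))
                 (sees-own-colour (x∉S (suc (suc zero)) ∘ sym)))

  code-positive : ∀ {T} (r : Shape T) x → code r ≡ inj₂ x → 1 ≤ centre x a b d
  code-positive {T} (inj₂ r) _ refl = centre-counted {T} r

  few-trees : ∀ m (T : Fin m → Subgraph n) → (∀ i → RainbowSTree c S (T i)) →
    (∀ i j → i ≢ j → InternallyDisjoint S (T i) (T j)) →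
    m ≤ 3 + rainbowCentres a b d
  few-trees m T rts disjoint =
    count-by-codes (λ x → centre x a b d) (code ∘ shape) codes-injective
                   (code-positive ∘ shape)
    where
    shape : ∀ i → Shape (T i)
    shape i = classify (T i) (rts i)
    codes-injective : Injective _≡_ _≡_ (code ∘ shape)
    codes-injective {i} {j} same with i ≟ j
    ... | yes i≡j = i≡j
    ... | no i≢j = contradiction same
          (codes-differ (proj₁ (proj₁ (rts i))) (proj₁ (proj₁ (rts j))) (disjoint i j i≢j) (shape i) (shape j))

final-bound : ∀ k {m R} → m ≤ 3 + R → 9 * suc k * R ≤ 2 * suc (suc k) ^ 2 →
  9 * suc k * m ≤ 2 * suc (suc k) ^ 2 + 27 * suc k
final-bound k {m} {R} m≤3+R few = begin
  9 * suc k * m                       ≤⟨ *-monoʳ-≤ (9 * suc k) m≤3+R ⟩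
  9 * suc k * (3 + R)                 ≡⟨ distribute (suc k) R ⟩
  27 * suc k + 9 * suc k * R          ≤⟨ +-monoʳ-≤ (27 * suc k) few ⟩
  27 * suc k + 2 * suc (suc k) ^ 2    ≡⟨ +-comm (27 * suc k) _ ⟩
  2 * suc (suc k) ^ 2 + 27 * suc k    ∎
  where
  open ≤-Reasoning
  distribute : ∀ p r → 9 * p * (3 + r) ≡ 27 * p + 9 * p * r
  distribute = solve-∀

lemma3p4 : (n : ℕ) → 3 ≤ n → (c : Coloring n) →
    Σ (Subset n) λ S → (∣ S ∣ ≡ 3) ×
      ((m : ℕ) (T : Fin m → Subgraph n) →
        (∀ i → RainbowSTree c S (T i)) →
        (∀ i j → i ≢ j → InternallyDisjoint S (T i) (T j)) →
        9 * (n ∸ 2) * m ≤ 2 * (n ∸ 1) ^ 2 + 27 * (n ∸ 2))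
lemma3p4 (suc (suc (suc k))) (s≤s (s≤s (s≤s _))) c =
  let (a , b , d , distinct , few) = few-centres k c
      open TreeShape c distinct
  in S , ∣S∣≡3 , λ m T rainbow disjoint → final-bound k (few-trees m T rainbow disjoint) few
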